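{- $T_2(6)=11$; that is, every triangle-free graph on $11$ vertices contains a $2$-sparse set of $6$ vertices, and there is a triangle-free graph on $10$ vertices containing no $2$-sparse set of $6$ vertices.
   Context: All graphs are finite and simple. A set $S$ of vertices of a graph $G$ is $k$-sparse if the induced subgraph $G[S]$ has maximum degree at most $k$. For integers $k\ge0$ and $j\ge1$, $T_k(j)$ denotes the minimum $n$ such that every triangle-free graph on $n$ vertices contains a $k$-sparse set of $j$ vertices. -}

module Defs where

open import Data.Nat using (ℕ; _≤_; _<_)
open import Data.Bool using (Bool; true; false; _∧_)
open import Data.Bool.Properties using (T?)
open import Data.Bool using (T)
open import Data.Empty using (⊥)
open import Data.Fin using (Fin)
open import Data.Fin.Subset using (Subset; _∈_; ∣_∣)
open import Data.Vec using (Vec; tabulate; lookup; count)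
open import Data.Product using (Σ; _×_)
open import Relation.Binary.PropositionalEquality using (_≡_)
open import Relation.Nullary using (¬_)

record Graph (n : ℕ) : Set where
  field
    adj    : Fin n → Fin n → Bool
    irrefl : ∀ v → adj v v ≡ false
    sym    : ∀ u v → adj u v ≡ adj v u

open Graph public

Adjacent : ∀ {n} → Graph n → Fin n → Fin n → Set
Adjacent G u v = adj G u v ≡ true

TriangleFree : ∀ {n} → Graph n → Set
TriangleFree G = ∀ u v w → Adjacent G u v → Adjacent G v w → Adjacent G u w → ⊥

-- number of neighbours of v lying in S  (= deg of v in G[S] when v ∈ S)
degIn : ∀ {n} → Graph n → Subset n → Fin n → ℕ
degIn G S v = count (λ b → T? b) (tabulate (λ w → lookup S w ∧ adj G v w))

Sparse : ∀ {n} → ℕ → Graph n → Subset n → Set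
Sparse k G S = ∀ v → v ∈ S → degIn G S v ≤ k

HasSparse : ℕ → ℕ → ℕ → Set
HasSparse k j n = (G : Graph n) → TriangleFree G →
  Σ (Subset n) (λ S → (∣ S ∣ ≡ j) × Sparse k G S)

T-is : ℕ → ℕ → ℕ → Set
T-is k j m = HasSparse k j m × (∀ n → n < m → ¬ HasSparse k j n)

module Submission where

-- Every graph has a bipartition in which each vertex has at least as many
-- neighbours across as on its own side: flip any vertex violating this, which strictly
-- lowers the number of monochromatic edges.  Let G be triangle-free on n ≥ 11 vertices.
-- A vertex of degree ≥ 6 has an independent neighbourhood of size ≥ 6.  Otherwise all
-- degrees are ≤ 5, so in such a bipartition every vertex has ≤ 2 neighbours on its own
-- side; both sides are 2-sparse and one of them has ≥ 6 vertices.  The same argument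
-- gives T_k(2k+2) ≤ 4k+3 for every k.
--
-- In K₅,₅ (and its induced subgraphs on ≤ 10 vertices) a 6-set meets both
-- sides and has ≥ 3 vertices on one of them, all adjacent to each of its vertices on the
-- other side; this is confirmed by exhaustive search.

open import Defs hiding (sym)
open import Data.Bool as Bool using (Bool; true; false; not; _∧_; _xor_)
open import Data.Bool.Properties using (T?; ∧-zeroʳ; xor-comm; xor-same; not-distribˡ-xor)
open import Data.Empty using (⊥; ⊥-elim)
open import Data.Fin using (Fin; zero; suc; toℕ; fromℕ<)
open import Data.Fin.Properties using (_≟_; suc-injective; any?; all?; toℕ-fromℕ<)
open import Data.Fin.Subset using (Subset; inside; outside; _⊆_; _∈_; ∣_∣) renaming (⊥ to ∅)
open import Data.Fin.Subset.Properties using (⊆-min; ∣⊥∣≡0; out⊆; in⊆in; anySubset?; _∈?_)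
open import Data.Nat using (ℕ; zero; suc; _+_; _≤_; _<_; z≤n; s≤s; _<ᵇ_)
  renaming (_≤?_ to _≤ℕ?_; _<?_ to _<ℕ?_; _≟_ to _≟ℕ_)
open import Data.Nat.Induction using (<-wellFounded)
open import Data.Nat.Properties
  using (+-0-commutativeMonoid; +-commutativeSemigroup; ≤-refl; ≤-reflexive; ≤-trans;
         +-mono-≤; +-monoˡ-≤; +-monoʳ-<; +-mono-<; +-cancelʳ-<; +-cancelˡ-≤;
         +-assoc; +-identityʳ; +-suc; ≤-pred; ≮⇒≥; ≰⇒>; 1+n≰n)
open import Algebra.Properties.CommutativeMonoid.Sum +-0-commutativeMonoid
  using (sum; sum-cong-≗; ∑-distrib-+; sum-replicate-zero)
open import Algebra.Properties.CommutativeSemigroup +-commutativeSemigroup using (xy∙z≈zy∙x)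
open import Data.Product using (Σ; ∃; _×_; _,_)
open import Data.Sum using (_⊎_; inj₁; inj₂; [_,_]′)
open import Data.Vec using ([]; _∷_; tabulate; lookup; count)
open import Data.Vec.Functional using (updateAt)
open import Data.Vec.Functional.Properties using (updateAt-updates; updateAt-minimal)
open import Data.Vec.Properties using (lookup∘tabulate; []=⇒lookup; lookup⇒[]=)
open import Function using (_∘_)
open import Induction.WellFounded using (Acc; acc)
open import Relation.Binary.PropositionalEquality
  using (_≡_; _≢_; refl; sym; trans; cong; cong₂; subst; module ≡-Reasoning)
open import Relation.Nullary using (¬_; Dec; yes; no; does; ¬?; contradiction)
open import Relation.Nullary.Decidable using (_×-dec_; _→-dec_; toWitness)
open import Relation.Unary using (Pred; Decidable)

𝟙 : Bool → ℕ
𝟙 true  = 1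
𝟙 false = 0

𝟙-split : ∀ s a → 𝟙 a ≡ 𝟙 (s ∧ a) + 𝟙 (not s ∧ a)
𝟙-split true  a = sym (+-identityʳ (𝟙 a))
𝟙-split false a = refl

card : ∀ {n} → (Fin n → Bool) → ℕ
card f = sum (λ i → 𝟙 (f i))

card-full : ∀ n → card {n} (λ _ → true) ≡ n
card-full zero    = refl
card-full (suc n) = cong suc (card-full n)

sum-mono-≤ : ∀ {n} {f g : Fin n → ℕ} → (∀ i → f i ≤ g i) → sum f ≤ sum g
sum-mono-≤ {zero}  f≤g = z≤n
sum-mono-≤ {suc n} f≤g = +-mono-≤ (f≤g zero) (sum-mono-≤ (f≤g ∘ suc))

sum-exchange : ∀ {n} (x : Fin n) (f g : Fin n → ℕ) → (∀ w → w ≢ x → f w ≡ g w) →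
               sum f + g x ≡ sum g + f x
sum-exchange zero f g f≗g = begin
  f zero + sum (f ∘ suc) + g zero ≡⟨ cong (λ s → f zero + s + g zero) tails-equal ⟩
  f zero + sum (g ∘ suc) + g zero ≡⟨ xy∙z≈zy∙x (f zero) _ _ ⟩
  g zero + sum (g ∘ suc) + f zero ∎
  where
  open ≡-Reasoning
  tails-equal = sum-cong-≗ λ w → f≗g (suc w) λ ()
sum-exchange (suc x) f g f≗g = begin
  f zero + sum (f ∘ suc) + g (suc x)   ≡⟨ +-assoc (f zero) _ _ ⟩
  f zero + (sum (f ∘ suc) + g (suc x)) ≡⟨ cong₂ _+_ (f≗g zero λ ()) tails-exchange ⟩
  g zero + (sum (g ∘ suc) + f (suc x)) ≡⟨ +-assoc (g zero) _ _ ⟨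
  g zero + sum (g ∘ suc) + f (suc x)   ∎
  where
  open ≡-Reasoning
  tails-exchange = sum-exchange x (f ∘ suc) (g ∘ suc) λ w w≢x → f≗g (suc w) (w≢x ∘ suc-injective)

m≤n∧m+n≤1+2k⇒m≤k : ∀ k {m n} → m ≤ n → m + n ≤ suc (k + k) → m ≤ k
m≤n∧m+n≤1+2k⇒m≤k k {m} {n} m≤n m+n≤1+2k with m ≤ℕ? k
... | yes m≤k = m≤k
... | no  m≰k = contradiction (begin
  suc (suc (k + k)) ≡⟨ cong suc (+-suc k k) ⟨
  suc k + suc k     ≤⟨ +-mono-≤ k<m (≤-trans k<m m≤n) ⟩
  m + n             ≤⟨ m+n≤1+2k ⟩
  suc (k + k)       ∎) 1+n≰n
  where
  open Data.Nat.Properties.≤-Reasoning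
  k<m = ≰⇒> m≰k

1+2k≤m+n⇒k<m⊎k<n : ∀ k {m n} → suc (k + k) ≤ m + n → k < m ⊎ k < n
1+2k≤m+n⇒k<m⊎k<n k {m} {n} 1+2k≤m+n with suc k ≤ℕ? m
... | yes k<m = inj₁ k<m
... | no  k≮m = inj₂ (+-cancelˡ-≤ k (suc k) n (begin
  k + suc k   ≡⟨ +-suc k k ⟩
  suc (k + k) ≤⟨ 1+2k≤m+n ⟩
  m + n       ≤⟨ +-monoˡ-≤ n (≤-pred (≰⇒> k≮m)) ⟩
  k + n       ∎))
  where open Data.Nat.Properties.≤-Reasoning

count-tabulate : ∀ {n p} {P : Pred Bool p} (P? : Decidable P) (f : Fin n → Bool) →
                 count P? (tabulate f) ≡ card (λ i → does (P? (f i)))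
count-tabulate {zero}  P? f = refl
count-tabulate {suc n} P? f with does (P? (f zero))
... | true  = cong suc (count-tabulate P? (f ∘ suc))
... | false = count-tabulate P? (f ∘ suc)

∣tabulate∣ : ∀ {n} (f : Fin n → Bool) → ∣ tabulate f ∣ ≡ card f
∣tabulate∣ f = trans (count-tabulate (Bool._≟ true) f) (sum-cong-≗ (cong 𝟙 ∘ does-≟true ∘ f))
  where
  does-≟true : ∀ b → does (b Bool.≟ true) ≡ b
  does-≟true true  = refl
  does-≟true false = refl

degIn≡card : ∀ {n} (G : Graph n) S v → degIn G S v ≡ card (λ w → lookup S w ∧ adj G v w)
degIn≡card G S v = count-tabulate T? (λ w → lookup S w ∧ adj G v w)

degIn-tabulate : ∀ {n} (G : Graph n) (f : Fin n → Bool) v →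
                 degIn G (tabulate f) v ≡ card (λ w → f w ∧ adj G v w)
degIn-tabulate G f v = trans (degIn≡card G (tabulate f) v)
  (sum-cong-≗ λ w → cong (λ b → 𝟙 (b ∧ adj G v w)) (lookup∘tabulate f w))

∈tabulate : ∀ {n} {f : Fin n → Bool} {v} → v ∈ tabulate f → f v ≡ true
∈tabulate {f = f} {v} v∈ = trans (sym (lookup∘tabulate f v)) ([]=⇒lookup v∈)

degIn-mono : ∀ {n} (G : Graph n) {S T : Subset n} → T ⊆ S → ∀ v → degIn G T v ≤ degIn G S v
degIn-mono G {S} {T} T⊆S v = begin
  degIn G T v                         ≡⟨ degIn≡card G T v ⟩
  card (λ w → lookup T w ∧ adj G v w) ≤⟨ sum-mono-≤ (λ w → 𝟙-∧-mono (lookup T w) (adj G v w) (T⊆S′ w)) ⟩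
  card (λ w → lookup S w ∧ adj G v w) ≡⟨ degIn≡card G S v ⟨
  degIn G S v                         ∎
  where
  open Data.Nat.Properties.≤-Reasoning
  T⊆S′ : ∀ w → lookup T w ≡ true → lookup S w ≡ true
  T⊆S′ w w∈T = []=⇒lookup (T⊆S (lookup⇒[]= w T w∈T))
  𝟙-∧-mono : ∀ a c {b} → (a ≡ true → b ≡ true) → 𝟙 (a ∧ c) ≤ 𝟙 (b ∧ c)
  𝟙-∧-mono false c     a⇒b = z≤n
  𝟙-∧-mono true  false a⇒b = z≤n
  𝟙-∧-mono true  true  a⇒b rewrite a⇒b refl = ≤-refl

Sparse-⊆ : ∀ {n k} (G : Graph n) {S T : Subset n} → T ⊆ S → Sparse k G S → Sparse k G T
Sparse-⊆ G T⊆S S-sparse v v∈T = ≤-trans (degIn-mono G T⊆S v) (S-sparse v (T⊆S v∈T))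

⊆-withSize : ∀ {n} k (S : Subset n) → k ≤ ∣ S ∣ → ∃ λ T → T ⊆ S × ∣ T ∣ ≡ k
⊆-withSize         zero    []            z≤n         = [] , (λ ()) , refl
⊆-withSize {suc n} zero    (inside ∷ S)  _           = ∅ , ⊆-min _ , ∣⊥∣≡0 (suc n)
⊆-withSize         (suc k) (inside ∷ S)  (s≤s k≤∣S∣) with ⊆-withSize k S k≤∣S∣
... | T , T⊆S , ∣T∣≡k = inside ∷ T , in⊆in T⊆S , cong suc ∣T∣≡k
⊆-withSize         k       (outside ∷ S) k≤∣S∣       with ⊆-withSize k S k≤∣S∣
... | T , T⊆S , ∣T∣≡k = outside ∷ T , out⊆ T⊆S , ∣T∣≡k

SparseSetOfSize : ∀ {n} → ℕ → ℕ → Graph n → Set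
SparseSetOfSize {n} k j G = Σ (Subset n) λ S → ∣ S ∣ ≡ j × Sparse k G S

sparse-withSize : ∀ {n k j} (G : Graph n) {S : Subset n} →
                  Sparse k G S → j ≤ ∣ S ∣ → SparseSetOfSize k j G
sparse-withSize G S-sparse j≤∣S∣ with ⊆-withSize _ _ j≤∣S∣
... | T , T⊆S , ∣T∣≡j = T , ∣T∣≡j , Sparse-⊆ G T⊆S S-sparse

neighbourhood : ∀ {n} → Graph n → Fin n → Subset n
neighbourhood G x = tabulate (adj G x)

degree : ∀ {n} → Graph n → Fin n → ℕ
degree G x = card (adj G x)

neighbourhood-independent : ∀ {n} (G : Graph n) → TriangleFree G →
                            ∀ x → Sparse 0 G (neighbourhood G x)
neighbourhood-independent {n} G tf x v v∈N = ≤-reflexive (begin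
  degIn G (neighbourhood G x) v         ≡⟨ degIn-tabulate G (adj G x) v ⟩
  card (λ w → adj G x w ∧ adj G v w)    ≡⟨ sum-cong-≗ noCommonNeighbour ⟩
  sum {n} (λ _ → 0)                     ≡⟨ sum-replicate-zero n ⟩
  0                                     ∎)
  where
  open ≡-Reasoning
  noCommonNeighbour : ∀ w → 𝟙 (adj G x w ∧ adj G v w) ≡ 0
  noCommonNeighbour w with adj G x w in xw | adj G v w in vw
  ... | true  | true  = ⊥-elim (tf x v w (∈tabulate v∈N) vw xw)
  ... | true  | false = refl
  ... | false | _     = refl

sameColour : Bool → Bool → Bool
sameColour a b = not (a xor b)

sameColour⇒≡ : ∀ a b → sameColour a b ≡ true → a ≡ b
sameColour⇒≡ true  true  _ = refl
sameColour⇒≡ false false _ = refl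

sameColour-notˡ : ∀ a b → sameColour (not a) b ≡ not (sameColour a b)
sameColour-notˡ a b = cong not (sym (not-distribˡ-xor a b))

colourClass : ∀ {n} → (Fin n → Bool) → Bool → Subset n
colourClass p b = tabulate (λ w → sameColour b (p w))

colourClasses-cover : ∀ {n} (p : Fin n → Bool) → ∣ colourClass p true ∣ + ∣ colourClass p false ∣ ≡ n
colourClasses-cover {n} p = begin
  ∣ colourClass p true ∣ + ∣ colourClass p false ∣     ≡⟨ cong₂ _+_ (∣tabulate∣ (class true)) (∣tabulate∣ (class false)) ⟩
  card (class true) + card (class false)              ≡⟨ ∑-distrib-+ (𝟙 ∘ class true) (𝟙 ∘ class false) ⟨
  sum (λ w → 𝟙 (class true w) + 𝟙 (class false w))   ≡⟨ sum-cong-≗ (oneClass ∘ p) ⟩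
  card {n} (λ _ → true)                               ≡⟨ card-full n ⟩
  n                                                   ∎
  where
  open ≡-Reasoning
  class : Bool → Fin n → Bool
  class b w = sameColour b (p w)
  oneClass : ∀ c → 𝟙 (sameColour true c) + 𝟙 (sameColour false c) ≡ 1
  oneClass true  = refl
  oneClass false = refl

module Bipartition {n} (G : Graph n) where

  monoEdge : (Fin n → Bool) → Fin n → Fin n → ℕ
  monoEdge p v w = 𝟙 (sameColour (p v) (p w) ∧ adj G v w)

  sameDeg : (Fin n → Bool) → Fin n → ℕ
  sameDeg p v = sum (monoEdge p v)

  crossDeg : (Fin n → Bool) → Fin n → ℕ
  crossDeg p v = card (λ w → not (sameColour (p v) (p w)) ∧ adj G v w)

  monoPairs : (Fin n → Bool) → ℕ
  monoPairs p = sum (sameDeg p)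

  flipAt : (Fin n → Bool) → Fin n → Fin n → Bool
  flipAt p x = updateAt p x not

  LocallyMaximal : (Fin n → Bool) → Set
  LocallyMaximal p = ∀ v → sameDeg p v ≤ crossDeg p v

  degree-split : ∀ p v → degree G v ≡ sameDeg p v + crossDeg p v
  degree-split p v = trans (sum-cong-≗ λ w → 𝟙-split (sameColour (p v) (p w)) (adj G v w))
                           (∑-distrib-+ (monoEdge p v) _)

  monoEdge-sym : ∀ p v w → monoEdge p v w ≡ monoEdge p w v
  monoEdge-sym p v w = cong₂ (λ s a → 𝟙 (not s ∧ a)) (xor-comm (p v) (p w)) (Graph.sym G v w)

  monoEdge-loop : ∀ p v → monoEdge p v v ≡ 0
  monoEdge-loop p v rewrite irrefl G v = cong 𝟙 (∧-zeroʳ _)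

  sameDeg-flipAt : ∀ p x → sameDeg (flipAt p x) x ≡ crossDeg p x
  sameDeg-flipAt p x = sum-cong-≗ pointwise
    where
    pointwise : ∀ w → monoEdge (flipAt p x) x w ≡ 𝟙 (not (sameColour (p x) (p w)) ∧ adj G x w)
    pointwise w with w ≟ x
    ... | yes refl rewrite irrefl G w = cong 𝟙 (trans (∧-zeroʳ _) (sym (∧-zeroʳ _)))
    ... | no w≢x = trans
      (cong₂ (λ a b → 𝟙 (sameColour a b ∧ adj G x w)) (updateAt-updates x p) (updateAt-minimal w x p w≢x))
      (cong (λ s → 𝟙 (s ∧ adj G x w)) (sameColour-notˡ (p x) (p w)))

  -- For v ≢ x, flipping x changes row v of the monochromatic adjacency only in column x.
  sameDeg-flipAt-off : ∀ p x v → v ≢ x →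
    sameDeg p v + monoEdge (flipAt p x) v x ≡ sameDeg (flipAt p x) v + monoEdge p v x
  sameDeg-flipAt-off p x v v≢x = sum-exchange x (monoEdge p v) (monoEdge (flipAt p x) v) λ w w≢x →
    cong₂ (λ a b → 𝟙 (sameColour a b ∧ adj G v w))
          (sym (updateAt-minimal v x p v≢x)) (sym (updateAt-minimal w x p w≢x))

  -- Flipping x changes monoPairs by 2 (sameDeg p′ x − sameDeg p x), stated without subtraction.
  monoPairs-flipAt : ∀ p x → let p′ = flipAt p x in
    monoPairs p + (sameDeg p′ x + sameDeg p′ x) ≡ monoPairs p′ + (sameDeg p x + sameDeg p x)
  monoPairs-flipAt p x = begin
    monoPairs p + (a′ + a′)   ≡⟨ +-assoc (monoPairs p) a′ a′ ⟨
    monoPairs p + a′ + a′     ≡⟨ cong₂ _+_ (withColumn p p′) (withLoop p′ p) ⟨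
    sum F + G′ x              ≡⟨ sum-exchange x F G′ (sameDeg-flipAt-off p x) ⟩
    sum G′ + F x              ≡⟨ cong₂ _+_ (withColumn p′ p) (withLoop p p′) ⟩
    monoPairs p′ + a + a      ≡⟨ +-assoc (monoPairs p′) a a ⟩
    monoPairs p′ + (a + a)    ∎
    where
    open ≡-Reasoning
    p′ = flipAt p x
    a  = sameDeg p x
    a′ = sameDeg p′ x
    F G′ : Fin n → ℕ
    F  v = sameDeg p v + monoEdge p′ v x
    G′ v = sameDeg p′ v + monoEdge p v x
    withColumn : ∀ q r → sum (λ v → sameDeg q v + monoEdge r v x) ≡ monoPairs q + sameDeg r x
    withColumn q r = trans (∑-distrib-+ (sameDeg q) _)
                           (cong (monoPairs q +_) (sum-cong-≗ λ v → monoEdge-sym r v x))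
    withLoop : ∀ q r → sameDeg q x + monoEdge r x x ≡ sameDeg q x
    withLoop q r = trans (cong (sameDeg q x +_) (monoEdge-loop r x)) (+-identityʳ _)

  monoPairs-flipAt-< : ∀ p x → crossDeg p x < sameDeg p x → monoPairs (flipAt p x) < monoPairs p
  monoPairs-flipAt-< p x cross<same = +-cancelʳ-< (a + a) _ _ (begin-strict
    monoPairs (flipAt p x) + (a + a)   ≡⟨ monoPairs-flipAt p x ⟨
    monoPairs p + (a′ + a′)            <⟨ +-monoʳ-< (monoPairs p) (+-mono-< a′<a a′<a) ⟩
    monoPairs p + (a + a)              ∎)
    where
    open Data.Nat.Properties.≤-Reasoning
    a  = sameDeg p x
    a′ = sameDeg (flipAt p x) x
    a′<a : a′ < a
    a′<a = subst (_< a) (sym (sameDeg-flipAt p x)) cross<same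

  locallyMaximal : ∃ LocallyMaximal
  locallyMaximal = descend (λ _ → true) (<-wellFounded _)
    where
    descend : ∀ p → Acc _<_ (monoPairs p) → ∃ LocallyMaximal
    descend p (acc smaller) with any? (λ x → crossDeg p x <ℕ? sameDeg p x)
    ... | yes (x , cross<same) = descend (flipAt p x) (smaller (monoPairs-flipAt-< p x cross<same))
    ... | no noneWorse         = p , λ v → ≮⇒≥ λ cross<same → noneWorse (v , cross<same)

  colourClass-sparse : ∀ {k} p → (∀ v → sameDeg p v ≤ k) → ∀ b → Sparse k G (colourClass p b)
  colourClass-sparse p sameDeg≤k b v v∈ with sameColour⇒≡ b (p v) (∈tabulate v∈)
  ... | refl = ≤-trans (≤-reflexive (degIn-tabulate G _ v)) (sameDeg≤k v)

maxDegree⇒sparse : ∀ k i {n} (G : Graph n) → (∀ v → degree G v ≤ suc (k + k)) → suc (i + i) ≤ n →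
                   SparseSetOfSize k (suc i) G
maxDegree⇒sparse k i G deg≤1+2k 1+2i≤n = fromCut locallyMaximal
  where
  open Bipartition G
  fromCut : ∃ LocallyMaximal → SparseSetOfSize k (suc i) G
  fromCut (p , maximal) = [ fromClass true , fromClass false ]′
    (1+2k≤m+n⇒k<m⊎k<n i (subst (suc (i + i) ≤_) (sym (colourClasses-cover p)) 1+2i≤n))
    where
    sameDeg≤k : ∀ v → sameDeg p v ≤ k
    sameDeg≤k v = m≤n∧m+n≤1+2k⇒m≤k k (maximal v)
                    (subst (_≤ suc (k + k)) (degree-split p v) (deg≤1+2k v))
    fromClass : ∀ b → i < ∣ colourClass p b ∣ → SparseSetOfSize k (suc i) G
    fromClass b = sparse-withSize G (colourClass-sparse p sameDeg≤k b)

triangleFree⇒sparse : ∀ k {n} → let d = suc (k + k) in suc (d + d) ≤ n → HasSparse k (suc d) n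
triangleFree⇒sparse k 1+2d≤n G triangleFree with any? (λ x → suc (suc (k + k)) ≤ℕ? degree G x)
... | yes (x , d<deg) = sparse-withSize G
  (λ v v∈N → ≤-trans (neighbourhood-independent G triangleFree x v v∈N) z≤n)
  (subst (suc (suc (k + k)) ≤_) (sym (∣tabulate∣ (adj G x))) d<deg)
... | no  noLarge     = maxDegree⇒sparse k (suc (k + k)) G
  (λ v → ≤-pred (≰⇒> λ d<deg → noLarge (v , d<deg))) 1+2d≤n

completeBipartite : ∀ {n} → (Fin n → Bool) → Graph n
completeBipartite side = record
  { adj    = λ u v → side u xor side v
  ; irrefl = λ v → xor-same (side v)
  ; sym    = λ u v → xor-comm (side u) (side v)
  }

completeBipartite-triangleFree : ∀ {n} (side : Fin n → Bool) → TriangleFree (completeBipartite side)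
completeBipartite-triangleFree side u v w = noOddTriangle (side u) (side v) (side w)
  where
  noOddTriangle : ∀ a b c → a xor b ≡ true → b xor c ≡ true → a xor c ≡ true → ⊥
  noOddTriangle true  true  _     ()
  noOddTriangle false false _     ()
  noOddTriangle true  false true  _ _ ()
  noOddTriangle true  false false _ ()
  noOddTriangle false true  true  _ ()
  noOddTriangle false true  false _ _ ()

sparse? : ∀ {n} k (G : Graph n) S → Dec (Sparse k G S)
sparse? k G S = all? λ v → v ∈? S →-dec degIn G S v ≤ℕ? k

K₅,₅↾ : ∀ n → Graph n
K₅,₅↾ n = completeBipartite (λ v → toℕ v <ᵇ 5)

K₅,₅↾-triangleFree : ∀ n → TriangleFree (K₅,₅↾ n)
K₅,₅↾-triangleFree n = completeBipartite-triangleFree (λ v → toℕ v <ᵇ 5)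

K₅,₅↾-noSparse : ∀ (i : Fin 11) → ¬ SparseSetOfSize 2 6 (K₅,₅↾ (toℕ i))
K₅,₅↾-noSparse = toWitness
  {a? = all? λ i → ¬? (anySubset? λ S → ∣ S ∣ ≟ℕ 6 ×-dec sparse? 2 (K₅,₅↾ (toℕ i)) S)} _

¬hasSparse<11 : ∀ n → n < 11 → ¬ HasSparse 2 6 n
¬hasSparse<11 n n<11 hasSparse = noSparse (hasSparse (K₅,₅↾ n) (K₅,₅↾-triangleFree n))
  where
  noSparse : ¬ SparseSetOfSize 2 6 (K₅,₅↾ n)
  noSparse = subst (λ m → ¬ SparseSetOfSize 2 6 (K₅,₅↾ m))
                   (toℕ-fromℕ< n<11) (K₅,₅↾-noSparse (fromℕ< n<11))

theorem3p5 : T-is 2 6 11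
theorem3p5 = triangleFree⇒sparse 2 ≤-refl , ¬hasSparse<11
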